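{- Let $p\in\mathrm{OFS}(\mathbb{Z}^+)$. If $\min(p)\ne\gcd(p)$, then $G'_p$ has more than $\gcd(p)$ connected components.
   Context: $\mathrm{OFS}(\mathbb{Z}^+)$ denotes the set of all nonempty strictly increasing finite sequences of positive integers. For $p\in\mathrm{OFS}(\mathbb{Z}^+)$, $|p|$ is its length, $p_i$ its $i$-th entry, $p|_i=(p_1,\ldots,p_i)$, $\gcd(p)$ the gcd of its entries, $\min(p)=p_1$, $\max(p)=p_{|p|}$. The map $R$: $R(p)=p$ if $|p|=1$; if $n=|p|>1$, form $(p_2-p_1,\ldots,p_n-p_1)$ and, if $p_1$ does not appear in it, insert $p_1$ so that the result is strictly increasing. $f$ is defined recursively by $f(p)=p_1$ if $|p|=1$ and $f(p)=p_1+f(R(p))$ if $|p|>1$. $fw$ is defined by: if $n=|p|>1$, $\gcd(p|_{n-1})=\gcd(p)$ and $\max(p)\ge f(p|_{n-1})$, then $fw(p)=fw(p|_{n-1})$; otherwise $fw(p)=f(p)$. For a positive integer $k$, $G(p,k)$ is the simple graph with vertex set $\{1,\ldots,k\}$ and edges $\{i,j\}$ with $|i-j|=p_t$ for some $t$. $G'_p=G(p,fw(p)-1)$. -}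

module Defs where

open import Data.Nat using (ℕ; zero; suc; _+_; _∸_; _≤_; _<_; _≤ᵇ_; _<ᵇ_; _≡ᵇ_)
open import Data.Nat.GCD using (gcd)
open import Data.Bool using (Bool; true; false; if_then_else_; _∧_)
open import Data.List using (List; []; _∷_; map; foldr; reverse; length)
open import Data.Bool.ListAction using (any)
open import Data.List.Membership.Propositional using (_∈_)
open import Data.List.Relation.Unary.All using (All)
open import Data.List.Relation.Unary.Linked using (Linked)
open import Data.Product using (_×_; ∃-syntax; Σ)
open import Data.Sum using (_⊎_)
open import Data.Fin using (Fin)
open import Relation.Binary.PropositionalEquality using (_≡_; _≢_)
open import Relation.Binary.Construct.Closure.ReflexiveTransitive using (Star)
open import Relation.Nullary using (¬_)

data NonEmpty : List ℕ → Set where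
  nonEmpty : ∀ {x xs} → NonEmpty (x ∷ xs)

record IsOFS (p : List ℕ) : Set where
  field
    nonempty   : NonEmpty p
    increasing : Linked _<_ p
    positive   : All (λ x → 0 < x) p

-- min(p) = p₁ (0 for the empty list, never used)
minL : List ℕ → ℕ
minL []      = 0
minL (x ∷ _) = x

-- max(p) = last entry (0 for the empty list, never used)
maxL : List ℕ → ℕ
maxL []           = 0
maxL (x ∷ [])     = x
maxL (_ ∷ y ∷ ys) = maxL (y ∷ ys)

gcdL : List ℕ → ℕ
gcdL = foldr gcd 0

insert : ℕ → List ℕ → List ℕ
insert x []       = x ∷ []
insert x (y ∷ ys) = if x <ᵇ y then x ∷ y ∷ ys else y ∷ insert x ys

R : List ℕ → List ℕ
R []               = []
R (x ∷ [])         = x ∷ []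
R (x ∷ xs@(_ ∷ _)) =
  let ds = map (λ y → y ∸ x) xs in
  if any (λ d → d ≡ᵇ x) ds then ds else insert x ds

-- For p ∈ OFS, max strictly decreases along R while |p| > 1 and stays ≥ 1,
-- so fuel max(p) is always sufficient (the fuel-0 clause is never reached).
fAux : ℕ → List ℕ → ℕ
fAux _       []               = 0
fAux _       (x ∷ [])         = x
fAux zero    (x ∷ _ ∷ _)      = 0
fAux (suc k) (x ∷ xs@(_ ∷ _)) = x + fAux k (R (x ∷ xs))

f : List ℕ → ℕ
f p = fAux (maxL p) p

-- fw, computed on the reversed list: rs = reverse p, so
-- rs = (max p) ∷ rest with reverse rest = p|_{n-1}.
fwRev : List ℕ → ℕ
fwRev []               = 0
fwRev (x ∷ [])         = f (x ∷ [])
fwRev (x ∷ rest@(_ ∷ _)) =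
  if (gcdL (reverse rest) ≡ᵇ gcdL (reverse (x ∷ rest))) ∧ (f (reverse rest) ≤ᵇ x)
  then fwRev rest
  else f (reverse (x ∷ rest))

fw : List ℕ → ℕ
fw p = fwRev (reverse p)

Vertex : ℕ → ℕ → Set
Vertex k i = 1 ≤ i × i ≤ k

Adj : List ℕ → ℕ → ℕ → ℕ → Set
Adj p k i j = Vertex k i × Vertex k j ×
              (∃[ d ] (d ∈ p × (j ≡ i + d ⊎ i ≡ j + d)))

Connected : List ℕ → ℕ → ℕ → ℕ → Set
Connected p k = Star (Adj p k)

-- G(p,k) has more than m connected components:
-- there are m+1 vertices, pairwise in different components.
MoreComponentsThan : List ℕ → ℕ → ℕ → Set
MoreComponentsThan p k m =
  Σ (Fin (suc m) → ℕ) λ v → ((∀ (a : Fin (suc m)) → Vertex k (v a)) ×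
          (∀ (a b : Fin (suc m)) → a ≢ b → ¬ Connected p k (v a) (v b)))

G'MoreComponentsThan : List ℕ → ℕ → Set
G'MoreComponentsThan p m = MoreComponentsThan p (fw p ∸ 1) m

module Submission where

-- Every edge length is a multiple of g, so connected vertices are congruent modulo g; hence a
-- split pair (vertices s and s + g in different components) makes s, s+1, …, s+g pairwise
-- disconnected (split-pair⇒components). The work is to find a split pair. Folding G(q, m + k′) onto G(R q, k′) lifts
-- split pairs along R (module Folding), which proves the main lemma split-pair: G(q₀ ++ [x], f − 1)
-- has a split pair whenever (q₀, x) is unstable. Finally fw only drops stable last entries,
-- which are ≥ fw and add no edges (fw-split-pair), and the theorem follows.

open import Data.Bool using (true; false; T)
open import Data.Bool.ListAction using (any)
open import Data.Empty using (⊥-elim)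
open import Data.Fin using (Fin; toℕ)
open import Data.Fin.Properties using (toℕ-injective; toℕ≤pred[n])
open import Data.List using (List; []; _∷_; map; reverse; _++_)
open import Data.List.Properties using (unfold-reverse; reverse-involutive)
open import Data.List.Membership.Propositional using (_∈_; _∉_)
open import Data.List.Membership.Propositional.Properties using (∈-++⁺ˡ; ∈-++⁺ʳ; ∈-++⁻; ∈-map⁺; ∈-map⁻)
open import Data.List.Relation.Unary.All as All using (All; []; _∷_)
import Data.List.Relation.Unary.All.Properties as All
open import Data.List.Relation.Unary.AllPairs using (AllPairs; []; _∷_)
open import Data.List.Relation.Unary.Any using (here; there)
import Data.List.Relation.Unary.Any.Properties as Any
open import Data.List.Relation.Unary.Linked.Properties using (Linked⇒AllPairs)
open import Data.Nat
open import Data.Nat.Properties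
open import Data.Nat.Divisibility
open import Data.Nat.DivMod using (_%_; _/_; m≡m%n+[m/n]*n; %-remove-+ʳ)
open import Data.Nat.GCD
open import Data.Product using (_×_; _,_; proj₁; proj₂; ∃-syntax)
open import Data.Sum using (_⊎_; inj₁; inj₂; [_,_]′; map₁)
open import Function using (id)
open import Data.Unit using (tt)
open import Relation.Binary.Definitions using (tri<; tri≈; tri>)
open import Relation.Binary.PropositionalEquality
open import Relation.Binary.Construct.Closure.ReflexiveTransitive as Star using (Star; ε; _◅_; _◅◅_)
open import Relation.Nullary using (¬_; Dec; yes; no)

open import Defs

Increasing : List ℕ → Set
Increasing = AllPairs _<_

Ordered : List ℕ → Set
Ordered q = Increasing q × All (0 <_) q

_≈ₑ_ : List ℕ → List ℕ → Set
l₁ ≈ₑ l₂ = ∀ y → (y ∈ l₁ → y ∈ l₂) × (y ∈ l₂ → y ∈ l₁)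

head<tail : ∀ {a l y} → Increasing (a ∷ l) → y ∈ l → a < y
head<tail (a<l ∷ _) y∈ = All.lookup a<l y∈

increasing-tail : ∀ {a l} → Increasing (a ∷ l) → Increasing l
increasing-tail (_ ∷ inc) = inc

head≤ : ∀ {a l y} → Increasing (a ∷ l) → y ∈ a ∷ l → a ≤ y
head≤ _   (here refl) = ≤-refl
head≤ inc (there y∈)  = <⇒≤ (head<tail inc y∈)

minL≤ : ∀ {l y} → Increasing l → y ∈ l → minL l ≤ y
minL≤ {_ ∷ _} = head≤

increasing-ext : ∀ {l₁ l₂} → Increasing l₁ → Increasing l₂ → l₁ ≈ₑ l₂ → l₁ ≡ l₂
increasing-ext {[]} {[]} _ _ _ = refl
increasing-ext {[]} {b ∷ _} _ _ e with proj₂ (e b) (here refl)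
... | ()
increasing-ext {a ∷ _} {[]} _ _ e with proj₁ (e a) (here refl)
... | ()
increasing-ext {a ∷ as} {b ∷ bs} i₁@(_ ∷ i₁') i₂@(_ ∷ i₂') e =
  cong₂ _∷_ a≡b (increasing-ext i₁' i₂' tails)
  where
  a≡b : a ≡ b
  a≡b = ≤-antisym (head≤ i₁ (proj₂ (e b) (here refl))) (head≤ i₂ (proj₁ (e a) (here refl)))
  tails : as ≈ₑ bs
  tails y = to , from
    where
    to : y ∈ as → y ∈ bs
    to y∈ with proj₁ (e y) (there y∈)
    ... | here refl = ⊥-elim (<-irrefl a≡b (head<tail i₁ y∈))
    ... | there q   = q
    from : y ∈ bs → y ∈ as
    from y∈ with proj₂ (e y) (there y∈)
    ... | here refl = ⊥-elim (<-irrefl (sym a≡b) (head<tail i₂ y∈))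
    ... | there q   = q

maxL-∈ : ∀ {l y} → y ∈ l → maxL l ∈ l
maxL-∈ {x ∷ []}     _ = here refl
maxL-∈ {x ∷ y ∷ ys} _ = there (maxL-∈ {y ∷ ys} (here refl))

maxL-greatest : ∀ {l y} → Increasing l → y ∈ l → y ≤ maxL l
maxL-greatest {a ∷ []}     _              (here refl) = ≤-refl
maxL-greatest {a ∷ b ∷ bs} inc@(_ ∷ inc') (here refl) =
  ≤-trans (<⇒≤ (head<tail inc (here refl))) (maxL-greatest inc' (here refl))
maxL-greatest {a ∷ b ∷ bs} (_ ∷ inc')     (there y∈)  = maxL-greatest inc' y∈

maxL-snoc : ∀ l x → maxL (l ++ x ∷ []) ≡ x
maxL-snoc []           x = refl
maxL-snoc (y ∷ [])     x = refl
maxL-snoc (y ∷ z ∷ zs) x = maxL-snoc (z ∷ zs) x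

minL-snoc : ∀ {l y} → NonEmpty l → minL (l ++ y ∷ []) ≡ minL l
minL-snoc nonEmpty = refl

minL-∈ : ∀ {l} → NonEmpty l → minL l ∈ l
minL-∈ nonEmpty = here refl

nonEmpty-∈ : ∀ {l : List ℕ} {y} → y ∈ l → NonEmpty l
nonEmpty-∈ (here _)  = nonEmpty
nonEmpty-∈ (there _) = nonEmpty

reverse-nonEmpty : ∀ (y : ℕ) ys → NonEmpty (reverse (y ∷ ys))
reverse-nonEmpty y ys = nonEmpty-∈ (Any.reverse⁺ (here {xs = ys} refl))

∈-snoc⁻ : ∀ {l : List ℕ} {x y} → y ∈ l ++ x ∷ [] → y ∈ l ⊎ y ≡ x
∈-snoc⁻ {l} y∈ with ∈-++⁻ l y∈
... | inj₁ p         = inj₁ p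
... | inj₂ (here p)  = inj₂ p

∈-snoc⁺ : ∀ {l : List ℕ} {x y} → y ∈ l ⊎ y ≡ x → y ∈ l ++ x ∷ []
∈-snoc⁺ (inj₁ p)        = ∈-++⁺ˡ p
∈-snoc⁺ {l} (inj₂ refl) = ∈-++⁺ʳ l (here refl)

increasing-snoc : ∀ {l x} → Increasing l → All (_< x) l → Increasing (l ++ x ∷ [])
increasing-snoc {[]}    _            _            = [] ∷ []
increasing-snoc {a ∷ _} (a<l ∷ inc) (a<x ∷ l<x) = All.++⁺ a<l (a<x ∷ []) ∷ increasing-snoc inc l<x

increasing-snoc⁻ : ∀ {l x} → Increasing (l ++ x ∷ []) → Increasing l × All (_< x) l
increasing-snoc⁻ {[]}     _           = [] , []
increasing-snoc⁻ {a ∷ as} (a<l ∷ inc) with increasing-snoc⁻ {as} inc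
... | inc' , l<x = (proj₁ (All.++⁻ as a<l) ∷ inc') , (All.lookup a<l (∈-++⁺ʳ as (here refl)) ∷ l<x)

ordered-snoc⁻ : ∀ {l x} → Ordered (l ++ x ∷ []) → Ordered l × All (_< x) l
ordered-snoc⁻ {l} (inc , pos) = (proj₁ (increasing-snoc⁻ inc) , proj₁ (All.++⁻ l pos)) , proj₂ (increasing-snoc⁻ inc)

∣-∸ : ∀ {d a b} → b ≤ a → d ∣ a → d ∣ b → d ∣ a ∸ b
∣-∸ {d} b≤a d∣a d∣b = ∣m+n∣m⇒∣n (subst (d ∣_) (sym (m+[n∸m]≡n b≤a)) d∣a) d∣b

gcdL-∣ : ∀ {l y} → y ∈ l → gcdL l ∣ y
gcdL-∣ {x ∷ xs} (here refl) = gcd[m,n]∣m x (gcdL xs)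
gcdL-∣ {x ∷ xs} (there y∈)  = ∣-trans (gcd[m,n]∣n x (gcdL xs)) (gcdL-∣ y∈)

gcdL-greatest : ∀ {d} l → (∀ {y} → y ∈ l → d ∣ y) → d ∣ gcdL l
gcdL-greatest {d} []  _ = d ∣0
gcdL-greatest (x ∷ xs) d∣ = gcd-greatest (d∣ (here refl)) (gcdL-greatest xs (λ y∈ → d∣ (there y∈)))

gcdL-positive : ∀ {l y} → y ∈ l → 0 < y → 0 < gcdL l
gcdL-positive {l} y∈ 0<y with gcdL l in eq
... | suc _ = s≤s z≤n
... | zero  = ⊥-elim (<⇒≢ 0<y (sym (0∣⇒≡0 (subst (_∣ _) eq (gcdL-∣ y∈)))))

gcdL≤ : ∀ {l y} → y ∈ l → 0 < y → gcdL l ≤ y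
gcdL≤ {y = suc _} y∈ _ = ∣⇒≤ (gcdL-∣ y∈)

-- Membership in R (m ∷ cs): the entry m and the differences c ∸ m for c ∈ cs.
-- (R only inserts m when it is not already one of the differences.)
differences : ℕ → List ℕ → List ℕ
differences m cs = map (λ y → y ∸ m) cs

InR : ℕ → List ℕ → ℕ → Set
InR m cs y = y ≡ m ⊎ ∃[ c ] (c ∈ cs × y ≡ c ∸ m)

any≡ᵇ-true : ∀ m ds → any (λ d → d ≡ᵇ m) ds ≡ true → m ∈ ds
any≡ᵇ-true m (d ∷ ds) eq with d ≡ᵇ m in e
... | true  = here (sym (≡ᵇ⇒≡ d m (subst T (sym e) tt)))
... | false = there (any≡ᵇ-true m ds eq)

any≡ᵇ-false : ∀ m ds → any (λ d → d ≡ᵇ m) ds ≡ false → m ∉ ds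
any≡ᵇ-false m (d ∷ ds) eq m∈ with d ≡ᵇ m in e | m∈
... | true  | _          = case eq
  where case : true ≢ false
        case ()
... | false | here refl  = subst T e (≡⇒≡ᵇ d d refl)
... | false | there m∈ds = any≡ᵇ-false m ds eq m∈ds

insert-∈⁻ : ∀ {x l y} → y ∈ insert x l → y ≡ x ⊎ y ∈ l
insert-∈⁻ {x} {[]} (here p) = inj₁ p
insert-∈⁻ {x} {z ∷ zs} y∈ with x <ᵇ z | y∈
... | true  | here p  = inj₁ p
... | true  | there p = inj₂ p
... | false | here p  = inj₂ (here p)
... | false | there p with insert-∈⁻ {x} {zs} p
...   | inj₁ q = inj₁ q
...   | inj₂ q = inj₂ (there q)

insert-∈⁺ : ∀ {x l y} → y ≡ x ⊎ y ∈ l → y ∈ insert x l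
insert-∈⁺ {x} {[]} (inj₁ p) = here p
insert-∈⁺ {x} {z ∷ zs} h with x <ᵇ z | h
... | true  | inj₁ p         = here p
... | true  | inj₂ p         = there p
... | false | inj₁ p         = there (insert-∈⁺ {x} {zs} (inj₁ p))
... | false | inj₂ (here p)  = here p
... | false | inj₂ (there p) = there (insert-∈⁺ {x} {zs} (inj₂ p))

insert-increasing : ∀ {x l} → Increasing l → x ∉ l → Increasing (insert x l)
insert-increasing {x} {[]} _ _ = [] ∷ []
insert-increasing {x} {z ∷ zs} (z<zs ∷ inc) x∉ with x <ᵇ z in e
... | true  = (x<z ∷ All.map (<-trans x<z) z<zs) ∷ z<zs ∷ inc
  where x<z = <ᵇ⇒< x z (subst T (sym e) tt)
... | false = All.tabulate z<insert ∷ insert-increasing inc (λ p → x∉ (there p))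
  where
  z<x : z < x
  z<x with <-cmp z x
  ... | tri< lt _ _    = lt
  ... | tri≈ _ refl _  = ⊥-elim (x∉ (here refl))
  ... | tri> _ _ gt    = ⊥-elim (subst T e (<⇒<ᵇ gt))
  z<insert : ∀ {w} → w ∈ insert x zs → z < w
  z<insert w∈ with insert-∈⁻ {x} {zs} w∈
  ... | inj₁ refl = z<x
  ... | inj₂ q    = All.lookup z<zs q

∈R⁻ : ∀ m cs {y} → y ∈ R (m ∷ cs) → InR m cs y
∈R⁻ m [] (here p) = inj₁ p
∈R⁻ m (b ∷ bs) y∈ with any (λ d → d ≡ᵇ m) (differences m (b ∷ bs))
... | true  = inj₂ (∈-map⁻ (λ y → y ∸ m) y∈)
... | false with insert-∈⁻ {m} {differences m (b ∷ bs)} y∈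
...   | inj₁ p = inj₁ p
...   | inj₂ p = inj₂ (∈-map⁻ (λ y → y ∸ m) p)

∈R⁺ : ∀ m cs {y} → InR m cs y → y ∈ R (m ∷ cs)
∈R⁺ m [] (inj₁ p) = here p
∈R⁺ m (b ∷ bs) {y} r with any (λ d → d ≡ᵇ m) (differences m (b ∷ bs)) in e | r
... | true  | inj₁ refl              = any≡ᵇ-true m (differences m (b ∷ bs)) e
... | true  | inj₂ (c , c∈ , refl)   = ∈-map⁺ (λ y → y ∸ m) c∈
... | false | inj₁ p                 = insert-∈⁺ {m} {differences m (b ∷ bs)} (inj₁ p)
... | false | inj₂ (c , c∈ , refl)   = insert-∈⁺ {m} {differences m (b ∷ bs)} (inj₂ (∈-map⁺ (λ y → y ∸ m) c∈))

m∈R : ∀ m cs → m ∈ R (m ∷ cs)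
m∈R m cs = ∈R⁺ m cs (inj₁ refl)

difference∈R : ∀ m cs {c} → c ∈ cs → c ∸ m ∈ R (m ∷ cs)
difference∈R m cs c∈ = ∈R⁺ m cs (inj₂ (_ , c∈ , refl))

differences-increasing : ∀ {m cs} → Increasing cs → All (m <_) cs → Increasing (differences m cs)
differences-increasing {m} {[]} _ _ = []
differences-increasing {m} {c ∷ cs} (c<cs ∷ inc) (m<c ∷ m<cs) = shift c<cs m<cs ∷ differences-increasing inc m<cs
  where
  shift : ∀ {ys} → All (c <_) ys → All (m <_) ys → All (c ∸ m <_) (differences m ys)
  shift []            []         = []
  shift (c<y ∷ c<ys) (_ ∷ m<ys) = ∸-monoˡ-< c<y (<⇒≤ m<c) ∷ shift c<ys m<ys

R-increasing : ∀ m cs → Increasing (m ∷ cs) → Increasing (R (m ∷ cs))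
R-increasing m []       inc = inc
R-increasing m (b ∷ bs) (m<cs ∷ inc) with any (λ d → d ≡ᵇ m) (differences m (b ∷ bs)) in e
... | true  = differences-increasing inc m<cs
... | false = insert-increasing (differences-increasing inc m<cs) (any≡ᵇ-false m (differences m (b ∷ bs)) e)

R-ordered : ∀ m cs → Ordered (m ∷ cs) → Ordered (R (m ∷ cs))
R-ordered m cs (inc@(m<cs ∷ _) , pos@(0<m ∷ _)) = R-increasing m cs inc , All.tabulate positive
  where
  positive : ∀ {y} → y ∈ R (m ∷ cs) → 0 < y
  positive y∈ with ∈R⁻ m cs y∈
  ... | inj₁ refl             = 0<m
  ... | inj₂ (c , c∈ , refl)  = m<n⇒0<n∸m (All.lookup m<cs c∈)

-- Every entry of R q is below max q (for |q| > 1); this bounds the recursion of f.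
R<maxL : ∀ {m b bs y} → Ordered (m ∷ b ∷ bs) → y ∈ R (m ∷ b ∷ bs) → y < maxL (b ∷ bs)
R<maxL {m} {b} {bs} (inc@(_ ∷ inc') , (0<m ∷ _)) y∈ with ∈R⁻ m (b ∷ bs) y∈
... | inj₁ refl            = <-≤-trans (head<tail inc (here refl)) (maxL-greatest inc' (here refl))
... | inj₂ (c , c∈ , refl) =
  <-≤-trans (∸-monoʳ-< {c} {m} {0} 0<m (<⇒≤ (head<tail inc c∈))) (maxL-greatest inc' c∈)

maxL-R< : ∀ {m b bs} → Ordered (m ∷ b ∷ bs) → maxL (R (m ∷ b ∷ bs)) < maxL (b ∷ bs)
maxL-R< {m} {b} {bs} ord = R<maxL ord (maxL-∈ (m∈R m (b ∷ bs)))

-- R preserves the gcd: (m, c₁ − m, …) and (m, c₁, …) generate the same ideal.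
gcdL-R : ∀ m cs → Increasing (m ∷ cs) → gcdL (R (m ∷ cs)) ≡ gcdL (m ∷ cs)
gcdL-R m cs inc = ∣-antisym (gcdL-greatest (m ∷ cs) G∣q) (gcdL-greatest (R (m ∷ cs)) G′∣Rq)
  where
  G = gcdL (R (m ∷ cs))
  G′ = gcdL (m ∷ cs)
  G∣q : ∀ {y} → y ∈ m ∷ cs → G ∣ y
  G∣q (here refl) = gcdL-∣ (m∈R m cs)
  G∣q (there c∈)  = ∣m∸n∣n⇒∣m G (<⇒≤ (head<tail inc c∈)) (gcdL-∣ (difference∈R m cs c∈)) (gcdL-∣ (m∈R m cs))
  G′∣Rq : ∀ {y} → y ∈ R (m ∷ cs) → G′ ∣ y
  G′∣Rq y∈ with ∈R⁻ m cs y∈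
  ... | inj₁ refl            = gcdL-∣ {m ∷ cs} (here refl)
  ... | inj₂ (c , c∈ , refl) =
    ∣-∸ (<⇒≤ (head<tail inc c∈)) (gcdL-∣ {m ∷ cs} (there c∈)) (gcdL-∣ {m ∷ cs} (here refl))

minL≡gcdL : ∀ {l} → Ordered l → gcdL l ∈ l → minL l ≡ gcdL l
minL≡gcdL {a ∷ as} (inc , pos) g∈ =
  ≤-antisym (head≤ inc g∈) (gcdL≤ {a ∷ as} (here refl) (All.lookup pos (here refl)))

R-is : ∀ m cs {t} → Increasing (m ∷ cs) → Increasing t →
       (∀ {y} → InR m cs y → y ∈ t) → (∀ {y} → y ∈ t → InR m cs y) → R (m ∷ cs) ≡ t
R-is m cs inc inc-t to from =
  increasing-ext (R-increasing m cs inc) inc-t (λ y → (λ y∈ → to (∈R⁻ m cs y∈)) , (λ y∈ → ∈R⁺ m cs (from y∈)))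

InR-snoc⁻ : ∀ {m cs x y} → InR m (cs ++ x ∷ []) y → InR m cs y ⊎ y ≡ x ∸ m
InR-snoc⁻ (inj₁ p) = inj₁ (inj₁ p)
InR-snoc⁻ {cs = cs} (inj₂ (c , c∈ , refl)) with ∈-snoc⁻ {cs} c∈
... | inj₁ p    = inj₁ (inj₂ (c , p , refl))
... | inj₂ refl = inj₂ refl

InR-snoc⁺ : ∀ {m cs x y} → InR m cs y ⊎ y ≡ x ∸ m → InR m (cs ++ x ∷ []) y
InR-snoc⁺ (inj₁ (inj₁ p))                       = inj₁ p
InR-snoc⁺ (inj₁ (inj₂ (c , c∈ , refl)))         = inj₂ (c , ∈-++⁺ˡ c∈ , refl)
InR-snoc⁺ {cs = cs} (inj₂ refl)                 = inj₂ (_ , ∈-++⁺ʳ cs (here refl) , refl)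

-- How R acts on an extended list m ∷ cs ++ [x] (with x its maximum): the new
-- difference x ∸ m lands above m (case A), on m (case B), or below m (case C).
module Extension (m : ℕ) (cs : List ℕ) (x : ℕ) (ord : Ordered (m ∷ cs ++ x ∷ [])) where

  ord₀ : Ordered (m ∷ cs)
  ord₀ = proj₁ (ordered-snoc⁻ {m ∷ cs} ord)

  below-x : All (_< x) (m ∷ cs)
  below-x = proj₂ (ordered-snoc⁻ {m ∷ cs} ord)

  m<x : m < x
  m<x = All.lookup below-x (here refl)

  above-m : All (m <_) (cs ++ x ∷ [])
  above-m = All.tabulate (head<tail (proj₁ ord))

  inc-tail : Increasing (cs ++ x ∷ [])
  inc-tail = increasing-tail (proj₁ ord)

  difference<x∸m : ∀ {c} → c ∈ cs → c ∸ m < x ∸ m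
  difference<x∸m c∈ = ∸-monoˡ-< (All.lookup below-x (there c∈)) (<⇒≤ (All.lookup above-m (∈-++⁺ˡ c∈)))

  caseA : m < x ∸ m → R (m ∷ cs ++ x ∷ []) ≡ R (m ∷ cs) ++ (x ∸ m) ∷ []
  caseA m<x∸m = R-is m (cs ++ x ∷ []) (proj₁ ord)
    (increasing-snoc (R-increasing m cs (proj₁ ord₀)) (All.tabulate below))
    (λ r → ∈-snoc⁺ {R (m ∷ cs)} (map₁ (∈R⁺ m cs) (InR-snoc⁻ {m} {cs} r)))
    (λ y∈ → InR-snoc⁺ {m} {cs} (map₁ (∈R⁻ m cs) (∈-snoc⁻ {R (m ∷ cs)} y∈)))
    where
    below : ∀ {y} → y ∈ R (m ∷ cs) → y < x ∸ m
    below y∈ with ∈R⁻ m cs y∈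
    ... | inj₁ refl             = m<x∸m
    ... | inj₂ (c , c∈ , refl)  = difference<x∸m c∈

  caseB : x ∸ m ≡ m → R (m ∷ cs ++ x ∷ []) ≡ R (m ∷ cs)
  caseB x∸m≡m = R-is m (cs ++ x ∷ []) (proj₁ ord) (R-increasing m cs (proj₁ ord₀))
    (λ r → to (InR-snoc⁻ {m} {cs} r))
    (λ y∈ → InR-snoc⁺ {m} {cs} (inj₁ (∈R⁻ m cs y∈)))
    where
    to : ∀ {y} → InR m cs y ⊎ y ≡ x ∸ m → y ∈ R (m ∷ cs)
    to (inj₁ r)    = ∈R⁺ m cs r
    to (inj₂ refl) = subst (_∈ R (m ∷ cs)) (sym x∸m≡m) (m∈R m cs)

  caseB-differences : x ∸ m ≡ m → R (m ∷ cs ++ x ∷ []) ≡ differences m cs ++ m ∷ []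
  caseB-differences x∸m≡m = R-is m (cs ++ x ∷ []) (proj₁ ord)
    (increasing-snoc (differences-increasing (proj₁ (increasing-snoc⁻ inc-tail)) (proj₁ (All.++⁻ cs above-m)))
                     (All.tabulate below))
    (λ r → to (InR-snoc⁻ {m} {cs} r))
    (λ y∈ → from (∈-snoc⁻ {differences m cs} y∈))
    where
    below : ∀ {y} → y ∈ differences m cs → y < m
    below y∈ with ∈-map⁻ (λ y → y ∸ m) y∈
    ... | c , c∈ , refl = subst (c ∸ m <_) x∸m≡m (difference<x∸m c∈)
    to : ∀ {y} → InR m cs y ⊎ y ≡ x ∸ m → y ∈ differences m cs ++ m ∷ []
    to (inj₁ (inj₁ p))                 = ∈-snoc⁺ {differences m cs} (inj₂ p)
    to (inj₁ (inj₂ (c , c∈ , refl)))   = ∈-snoc⁺ {differences m cs} (inj₁ (∈-map⁺ (λ y → y ∸ m) c∈))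
    to (inj₂ p)                        = ∈-snoc⁺ {differences m cs} (inj₂ (trans p x∸m≡m))
    from : ∀ {y} → y ∈ differences m cs ⊎ y ≡ m → InR m (cs ++ x ∷ []) y
    from (inj₁ y∈) with ∈-map⁻ (λ y → y ∸ m) y∈
    ... | c , c∈ , refl = inj₂ (c , ∈-++⁺ˡ c∈ , refl)
    from (inj₂ p) = inj₁ p

  caseC : x ∸ m < m → R (m ∷ cs ++ x ∷ []) ≡ differences m (cs ++ x ∷ []) ++ m ∷ []
  caseC x∸m<m = R-is m (cs ++ x ∷ []) (proj₁ ord)
    (increasing-snoc (differences-increasing inc-tail above-m) (All.tabulate below))
    to from
    where
    below : ∀ {y} → y ∈ differences m (cs ++ x ∷ []) → y < m
    below y∈ with ∈-map⁻ (λ y → y ∸ m) y∈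
    ... | c , c∈ , refl with ∈-snoc⁻ {cs} c∈
    ...   | inj₁ c∈cs = <-trans (difference<x∸m c∈cs) x∸m<m
    ...   | inj₂ refl = x∸m<m
    to : ∀ {y} → InR m (cs ++ x ∷ []) y → y ∈ differences m (cs ++ x ∷ []) ++ m ∷ []
    to (inj₁ p)                = ∈-snoc⁺ {differences m (cs ++ x ∷ [])} (inj₂ p)
    to (inj₂ (c , c∈ , refl))  = ∈-snoc⁺ {differences m (cs ++ x ∷ [])} (inj₁ (∈-map⁺ (λ y → y ∸ m) c∈))
    from : ∀ {y} → y ∈ differences m (cs ++ x ∷ []) ++ m ∷ [] → InR m (cs ++ x ∷ []) y
    from y∈ with ∈-snoc⁻ {differences m (cs ++ x ∷ [])} y∈
    ... | inj₂ p = inj₁ p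
    ... | inj₁ d∈ = inj₂ (∈-map⁻ (λ y → y ∸ m) d∈)

fuel-irrelevant : ∀ k k′ q → Ordered q → maxL q ≤ k → maxL q ≤ k′ → fAux k q ≡ fAux k′ q
fuel-irrelevant k       k′       []           _   _  _   = refl
fuel-irrelevant k       k′       (x ∷ [])     _   _  _   = refl
fuel-irrelevant zero    k′       (m ∷ b ∷ bs) ord le _   = ⊥-elim (<⇒≱ (≤-<-trans z≤n (maxL-R< ord)) le)
fuel-irrelevant (suc k) zero     (m ∷ b ∷ bs) ord _  le′ = ⊥-elim (<⇒≱ (≤-<-trans z≤n (maxL-R< ord)) le′)
fuel-irrelevant (suc k) (suc k′) (m ∷ b ∷ bs) ord le le′ =
  cong (m +_) (fuel-irrelevant k k′ (R (m ∷ b ∷ bs)) (R-ordered m (b ∷ bs) ord)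
                 (≤-pred (<-≤-trans (maxL-R< ord) le)) (≤-pred (<-≤-trans (maxL-R< ord) le′)))

f-step : ∀ {m b bs} → Ordered (m ∷ b ∷ bs) → f (m ∷ b ∷ bs) ≡ m + f (R (m ∷ b ∷ bs))
f-step {m} {b} {bs} ord with maxL (b ∷ bs) | maxL-R< ord
... | suc k | maxR<max =
  cong (m +_) (fuel-irrelevant k (maxL (R (m ∷ b ∷ bs))) (R (m ∷ b ∷ bs)) (R-ordered m (b ∷ bs) ord)
                 (≤-pred maxR<max) ≤-refl)

f-step-snoc : ∀ {m} cs {x} → Ordered (m ∷ cs ++ x ∷ []) → f (m ∷ cs ++ x ∷ []) ≡ m + f (R (m ∷ cs ++ x ∷ []))
f-step-snoc []      ord = f-step ord
f-step-snoc (_ ∷ _) ord = f-step ord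

f≥maxL : ∀ q → Ordered q → maxL q ≤ f q
f≥maxL q ord = go (suc (maxL q)) q ord ≤-refl
  where
  go : ∀ n q → Ordered q → maxL q < n → maxL q ≤ f q
  go n       []           _   _  = z≤n
  go n       (x ∷ [])     _   _  = ≤-refl
  go (suc n) (m ∷ b ∷ bs) ord lt = begin
    maxL (b ∷ bs)           ≡⟨ m+[n∸m]≡n m≤M ⟨
    m + (maxL (b ∷ bs) ∸ m) ≤⟨ +-monoʳ-≤ m (≤-trans (maxL-greatest (proj₁ ordR) M∸m∈R) IH) ⟩
    m + f (R (m ∷ b ∷ bs))  ≡⟨ f-step ord ⟨
    f (m ∷ b ∷ bs)          ∎
    where
    open ≤-Reasoning
    ordR = R-ordered m (b ∷ bs) ord
    m≤M : m ≤ maxL (b ∷ bs)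
    m≤M = maxL-greatest (proj₁ ord) (here refl)
    M∸m∈R : maxL (b ∷ bs) ∸ m ∈ R (m ∷ b ∷ bs)
    M∸m∈R = difference∈R m (b ∷ bs) (maxL-∈ {b ∷ bs} (here refl))
    IH : maxL (R (m ∷ b ∷ bs)) ≤ f (R (m ∷ b ∷ bs))
    IH = go n (R (m ∷ b ∷ bs)) ordR (<-≤-trans (maxL-R< ord) (≤-pred lt))

-- For |q| > 1, f(q) ≥ 2·min(q), since f(q) = m + f(R q) and m ∈ R q.
f≥2min : ∀ m c cs → Ordered (m ∷ c ∷ cs) → m + m ≤ f (m ∷ c ∷ cs)
f≥2min m c cs ord = subst (m + m ≤_) (sym (f-step ord))
  (+-monoʳ-≤ m (≤-trans (maxL-greatest (proj₁ ordR) (m∈R m (c ∷ cs))) (f≥maxL (R (m ∷ c ∷ cs)) ordR)))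
  where ordR = R-ordered m (c ∷ cs) ord

maxL-R : ∀ {m b bs} → Ordered (m ∷ b ∷ bs) → m ≤ b ∸ m → maxL (R (m ∷ b ∷ bs)) ≡ maxL (b ∷ bs) ∸ m
maxL-R {m} {b} {bs} ord m≤b∸m =
  ≤-antisym (below-last (maxL-∈ M∸m∈R)) (maxL-greatest (R-increasing m (b ∷ bs) (proj₁ ord)) M∸m∈R)
  where
  inc-bs = increasing-tail (proj₁ ord)
  M∸m∈R : maxL (b ∷ bs) ∸ m ∈ R (m ∷ b ∷ bs)
  M∸m∈R = difference∈R m (b ∷ bs) (maxL-∈ {b ∷ bs} (here refl))
  below-last : ∀ {y} → y ∈ R (m ∷ b ∷ bs) → y ≤ maxL (b ∷ bs) ∸ m
  below-last y∈ with ∈R⁻ m (b ∷ bs) y∈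
  ... | inj₁ refl            = ≤-trans m≤b∸m (∸-monoˡ-≤ m (maxL-greatest inc-bs (here refl)))
  ... | inj₂ (c , c∈ , refl) = ∸-monoˡ-≤ m (maxL-greatest inc-bs c∈)

-- If min(q) = gcd(q) then f(q) = max(q): R q again has min = gcd (= min q), and
-- max(R q) = max(q) ∸ min(q), so f(q) = min q + (max q ∸ min q).
f≡maxL : ∀ q → Ordered q → gcdL q ≡ minL q → f q ≡ maxL q
f≡maxL q ord g≡min = go (suc (maxL q)) q ord g≡min ≤-refl
  where
  go : ∀ n q → Ordered q → gcdL q ≡ minL q → maxL q < n → f q ≡ maxL q
  go n       []           _   _      _  = refl
  go n       (x ∷ [])     _   _      _  = refl
  go (suc n) (m ∷ b ∷ bs) ord g≡m lt = begin
    f (m ∷ b ∷ bs)           ≡⟨ f-step ord ⟩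
    m + f Rq                 ≡⟨ cong (m +_) (go n Rq ordR (trans gR (sym minR)) (<-≤-trans (maxL-R< ord) (≤-pred lt))) ⟩
    m + maxL Rq              ≡⟨ cong (m +_) (maxL-R ord m≤b∸m) ⟩
    m + (maxL (b ∷ bs) ∸ m)  ≡⟨ m+[n∸m]≡n (maxL-greatest (proj₁ ord) (here refl)) ⟩
    maxL (b ∷ bs)            ∎
    where
    open ≡-Reasoning
    Rq = R (m ∷ b ∷ bs)
    ordR = R-ordered m (b ∷ bs) ord
    gR : gcdL Rq ≡ m
    gR = trans (gcdL-R m (b ∷ bs) (proj₁ ord)) g≡m
    minR : minL Rq ≡ m
    minR = trans (minL≡gcdL ordR (subst (_∈ Rq) (sym gR) (m∈R m (b ∷ bs)))) gR
    m≤b∸m : m ≤ b ∸ m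
    m≤b∸m = subst (_≤ b ∸ m) minR (minL≤ (proj₁ ordR) (difference∈R m (b ∷ bs) (here refl)))

-- (q₀, x) is stable when appending x keeps the gcd and x ≥ f(q₀); this is the condition
-- under which fw(q₀ ++ [x]) = fw(q₀).
Stable : List ℕ → ℕ → Set
Stable q₀ x = gcdL q₀ ≡ gcdL (q₀ ++ x ∷ []) × f q₀ ≤ x

-- Induction along R: the new difference x ∸ m either lies above m (and the hypotheses pass to
-- R q₀ and x ∸ m), or equals m (and R forgets x), or lies below m (impossible as 2m ≤ f q₀ ≤ x).
f-snoc : ∀ q₀ x → NonEmpty q₀ → Ordered (q₀ ++ x ∷ []) → Stable q₀ x → f (q₀ ++ x ∷ []) ≡ x
f-snoc q₀ x ne ord (g≡ , fq₀≤x) = go (suc x) q₀ x ne ord g≡ fq₀≤x ≤-refl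
  where
  go : ∀ n q₀ x → NonEmpty q₀ → Ordered (q₀ ++ x ∷ []) →
       gcdL q₀ ≡ gcdL (q₀ ++ x ∷ []) → f q₀ ≤ x → x < n → f (q₀ ++ x ∷ []) ≡ x
  go (suc n) (m ∷ []) x _ ord g≡ _ _ =
    f≡maxL (m ∷ x ∷ []) ord (sym (trans (sym (gcd-identityʳ m)) g≡))
  go (suc n) (m ∷ c ∷ cs) x _ ord g≡ fq₀≤x x<n with <-cmp m (x ∸ m)
  ... | tri< m<x∸m _ _ = begin
    f (m ∷ c ∷ cs ++ x ∷ [])        ≡⟨ f-step ord ⟩
    m + f (R (m ∷ c ∷ cs ++ x ∷ [])) ≡⟨ cong (λ l → m + f l) (caseA m<x∸m) ⟩
    m + f (Rq₀ ++ (x ∸ m) ∷ [])      ≡⟨ cong (m +_) IH ⟩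
    m + (x ∸ m)                      ≡⟨ m+[n∸m]≡n (<⇒≤ m<x) ⟩
    x                                ∎
    where
    open ≡-Reasoning
    open Extension m (c ∷ cs) x ord
    Rq₀ = R (m ∷ c ∷ cs)
    g-R : gcdL Rq₀ ≡ gcdL (Rq₀ ++ (x ∸ m) ∷ [])
    g-R = begin
      gcdL Rq₀                          ≡⟨ gcdL-R m (c ∷ cs) (proj₁ ord₀) ⟩
      gcdL (m ∷ c ∷ cs)                 ≡⟨ g≡ ⟩
      gcdL (m ∷ c ∷ cs ++ x ∷ [])       ≡⟨ gcdL-R m (c ∷ cs ++ x ∷ []) (proj₁ ord) ⟨
      gcdL (R (m ∷ c ∷ cs ++ x ∷ []))   ≡⟨ cong gcdL (caseA m<x∸m) ⟩
      gcdL (Rq₀ ++ (x ∸ m) ∷ [])        ∎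
    fR≤ : f Rq₀ ≤ x ∸ m
    fR≤ = subst (_≤ x ∸ m) (m+n∸m≡n m (f Rq₀)) (∸-monoˡ-≤ m (subst (_≤ x) (f-step ord₀) fq₀≤x))
    IH = go n Rq₀ (x ∸ m) (nonEmpty-∈ (m∈R m (c ∷ cs)))
            (subst Ordered (caseA m<x∸m) (R-ordered m (c ∷ cs ++ x ∷ []) ord)) g-R fR≤
            (<-≤-trans (∸-monoʳ-< {x} {m} {0} (All.lookup (proj₂ ord) (here refl)) (<⇒≤ m<x)) (≤-pred x<n))
  ... | tri≈ _ m≡x∸m _ = ≤-antisym (subst (_≤ x) (sym fq≡fq₀) fq₀≤x)
                           (subst (_≤ f (m ∷ c ∷ cs ++ x ∷ [])) (maxL-snoc (m ∷ c ∷ cs) x) (f≥maxL _ ord))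
    where
    open Extension m (c ∷ cs) x ord
    fq≡fq₀ : f (m ∷ c ∷ cs ++ x ∷ []) ≡ f (m ∷ c ∷ cs)
    fq≡fq₀ = trans (f-step ord) (trans (cong (λ l → m + f l) (caseB (sym m≡x∸m))) (sym (f-step ord₀)))
  ... | tri> _ _ x∸m<m = ⊥-elim (<⇒≱ x∸m<m m≤x∸m)
    where
    open Extension m (c ∷ cs) x ord
    m≤x∸m : m ≤ x ∸ m
    m≤x∸m = subst (_≤ x ∸ m) (m+n∸m≡n m m) (∸-monoˡ-≤ m (≤-trans (f≥2min m c cs ord₀) fq₀≤x))

adj-sym : ∀ {q k i j} → Adj q k i j → Adj q k j i
adj-sym (vi , vj , d , d∈ , inj₁ e) = vj , vi , d , d∈ , inj₂ e
adj-sym (vi , vj , d , d∈ , inj₂ e) = vj , vi , d , d∈ , inj₁ e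

connected-sym : ∀ {q k i j} → Connected q k i j → Connected q k j i
connected-sym = Star.reverse adj-sym

connected-beyond : ∀ {q k a b} → Connected q k a b → k < a → b ≡ a
connected-beyond ε                  _   = refl
connected-beyond ((va , _) ◅ _) k<a = ⊥-elim (<⇒≱ k<a (proj₂ va))

connected-drop-large : ∀ {l x k u v} → Connected (l ++ x ∷ []) k u v → k ≤ x → Connected l k u v
connected-drop-large ε _ = ε
connected-drop-large {l} ((vi , vj , d , d∈ , dir) ◅ path) k≤x with ∈-snoc⁻ {l} d∈
... | inj₁ d∈l = (vi , vj , d , d∈l , dir) ◅ connected-drop-large path k≤x
... | inj₂ refl with dir
...   | inj₁ refl = ⊥-elim (<⇒≱ (+-monoˡ-< d (proj₁ vi)) (≤-trans (proj₂ vj) k≤x))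
...   | inj₂ refl = ⊥-elim (<⇒≱ (+-monoˡ-< d (proj₁ vj)) (≤-trans (proj₂ vi) k≤x))

connected-% : ∀ {q k g u v} .{{_ : NonZero g}} → (∀ {d} → d ∈ q → g ∣ d) →
              Connected q k u v → u % g ≡ v % g
connected-%         g∣ ε = refl
connected-% {g = g} g∣ ((_ , _ , d , d∈ , dir) ◅ path) = trans (edge dir) (connected-% g∣ path)
  where
  edge : ∀ {i j} → j ≡ i + d ⊎ i ≡ j + d → i % g ≡ j % g
  edge {i} (inj₁ refl) = sym (%-remove-+ʳ i (g∣ d∈))
  edge {j = j} (inj₂ refl) = %-remove-+ʳ j (g∣ d∈)

%-cong⇒∣∸ : ∀ {g u v} .{{_ : NonZero g}} → u % g ≡ v % g → g ∣ v ∸ u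
%-cong⇒∣∸ {g} {u} {v} eq = divides (v / g ∸ u / g) (begin
  v ∸ u                                     ≡⟨ cong₂ _∸_ (m≡m%n+[m/n]*n v g) (m≡m%n+[m/n]*n u g) ⟩
  (v % g + v / g * g) ∸ (u % g + u / g * g) ≡⟨ cong (λ r → (v % g + v / g * g) ∸ (r + u / g * g)) eq ⟩
  (v % g + v / g * g) ∸ (v % g + u / g * g) ≡⟨ [m+n]∸[m+o]≡n∸o (v % g) _ _ ⟩
  v / g * g ∸ u / g * g                     ≡⟨ *-distribʳ-∸ g (v / g) (u / g) ⟨
  (v / g ∸ u / g) * g                       ∎)
  where open ≡-Reasoning

window-% : ∀ {g s i j} .{{_ : NonZero g}} → i < j → j ≤ g → (s + i) % g ≡ (s + j) % g → i ≡ 0 × j ≡ g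
window-% {g} {s} {i} {j} i<j j≤g eq = i≡0 , ≤-antisym j≤g g≤j
  where
  g∣j∸i : g ∣ j ∸ i
  g∣j∸i = subst (g ∣_) ([m+n]∸[m+o]≡n∸o s j i) (%-cong⇒∣∸ eq)
  g≤j∸i : g ≤ j ∸ i
  g≤j∸i = ∣⇒≤ ⦃ ≢-nonZero (m<n⇒n≢0 (m<n⇒0<n∸m i<j)) ⦄ g∣j∸i
  g≤j : g ≤ j
  g≤j = ≤-trans g≤j∸i (m∸n≤m j i)
  i≡0 : i ≡ 0
  i≡0 = n≤0⇒n≡0 (≮⇒≥ (λ 0<i → <⇒≱ (∸-monoʳ-< {j} {i} {0} 0<i (<⇒≤ i<j)) (≤-trans j≤g g≤j∸i)))

SplitPair : List ℕ → ℕ → ℕ → Set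
SplitPair q k g = ∃[ s ] (1 ≤ s × s + g ≤ k × ¬ Connected q k s (s + g))

split-pair⇒components : ∀ {q k g} .{{_ : NonZero g}} → (∀ {d} → d ∈ q → g ∣ d) →
                        SplitPair q k g → MoreComponentsThan q k g
split-pair⇒components {q} {k} {g} g∣ (s , 1≤s , s+g≤k , split) = vertex , is-vertex , disconnected
  where
  vertex : Fin (suc g) → ℕ
  vertex a = s + toℕ a
  is-vertex : ∀ a → Vertex k (vertex a)
  is-vertex a = ≤-trans 1≤s (m≤m+n s (toℕ a)) , ≤-trans (+-monoʳ-≤ s (toℕ≤pred[n] a)) s+g≤k
  ordered : ∀ {i j} → i < j → j ≤ g → ¬ Connected q k (s + i) (s + j)
  ordered i<j j≤g path with window-% {s = s} i<j j≤g (connected-% g∣ path)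
  ... | refl , refl = split (subst (λ t → Connected q k t (s + g)) (+-identityʳ s) path)
  disconnected : ∀ a b → a ≢ b → ¬ Connected q k (vertex a) (vertex b)
  disconnected a b a≢b path with <-cmp (toℕ a) (toℕ b)
  ... | tri< lt _ _ = ordered lt (toℕ≤pred[n] b) path
  ... | tri≈ _ e _  = a≢b (toℕ-injective e)
  ... | tri> _ _ gt = ordered gt (toℕ≤pred[n] a) (connected-sym path)

-- Every edge becomes a path (an edge of length z splits into z ∸ m followed by m),
-- so split pairs of G(r, k′) remain split in G(m ∷ xs, m + k′).
module Folding (m k′ : ℕ) (r xs : List ℕ) (m∈r : m ∈ r)
               (difference∈r : ∀ {z} → z ∈ xs → z ∸ m ∈ r) (m<xs : ∀ {z} → z ∈ xs → m < z) where

  fold : ℕ → ℕ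
  fold i with i ≤? k′ | m <? i
  ... | yes _ | _     = i
  ... | no _  | yes _ = i ∸ m
  ... | no _  | no _  = i

  fold-low : ∀ {i} → i ≤ k′ → fold i ≡ i
  fold-low {i} i≤k′ with i ≤? k′
  ... | yes _ = refl
  ... | no i≰k′ = ⊥-elim (i≰k′ i≤k′)

  fold-high : ∀ {i} → k′ < i → m < i → fold i ≡ i ∸ m
  fold-high {i} k′<i m<i with i ≤? k′ | m <? i
  ... | yes i≤k′ | _     = ⊥-elim (<⇒≱ k′<i i≤k′)
  ... | no _     | yes _ = refl
  ... | no _     | no m≮i = ⊥-elim (m≮i m<i)

  fold-middle : ∀ {i} → k′ < i → i ≤ m → fold i ≡ i
  fold-middle {i} k′<i i≤m with i ≤? k′ | m <? i
  ... | yes i≤k′ | _       = ⊥-elim (<⇒≱ k′<i i≤k′)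
  ... | no _     | yes m<i = ⊥-elim (<⇒≱ m<i i≤m)
  ... | no _     | no _    = refl

  fold≤ : ∀ i → fold i ≤ i
  fold≤ i with i ≤? k′ | m <? i
  ... | yes _ | _     = ≤-refl
  ... | no _  | yes _ = m∸n≤m i m
  ... | no _  | no _  = ≤-refl

  Path = Star (Adj r k′)

  fold-edge-m : ∀ {i} → 1 ≤ i → i + m ≤ m + k′ → Dec (i + m ≤ k′) → Path (fold i) (fold (i + m))
  fold-edge-m {i} 1≤i _ (yes i+m≤k′) = subst₂ Path (sym (fold-low i≤k′)) (sym (fold-low i+m≤k′))
    (((1≤i , i≤k′) , (≤-trans 1≤i (m≤m+n i m) , i+m≤k′) , m , m∈r , inj₁ refl) ◅ ε)
    where i≤k′ = ≤-trans (m≤m+n i m) i+m≤k′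
  fold-edge-m {i} 1≤i le (no i+m≰k′) = subst₂ Path (sym (fold-low i≤k′)) (sym fold-i+m) ε
    where
    i≤k′ = +-cancelʳ-≤ m i k′ (subst (i + m ≤_) (+-comm m k′) le)
    fold-i+m : fold (i + m) ≡ i
    fold-i+m = trans (fold-high (≰⇒> i+m≰k′) (<-≤-trans (m<m+n m 1≤i) (≤-reflexive (+-comm m i)))) (m+n∸n≡m i m)

  fold-edge-z : ∀ {i z} → 1 ≤ i → i + z ≤ m + k′ → z ∈ xs → Dec (i + z ≤ k′) → Path (fold i) (fold (i + z))
  fold-edge-z {i} {z} 1≤i _ z∈ (yes i+z≤k′) = subst₂ Path (sym (fold-low i≤k′)) (sym (fold-low i+z≤k′))
    (edge-e ◅ (((≤-trans 1≤i (m≤m+n i e) , i+e≤k′) , (≤-trans 1≤i (m≤m+n i z) , i+z≤k′) ,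
                m , m∈r , inj₁ (sym i+e+m≡i+z)) ◅ ε))
    where
    e = z ∸ m
    i+e+m≡i+z : i + e + m ≡ i + z
    i+e+m≡i+z = trans (+-assoc i e m) (cong (i +_) (m∸n+n≡m (<⇒≤ (m<xs z∈))))
    i+e≤k′ : i + e ≤ k′
    i+e≤k′ = ≤-trans (m≤m+n (i + e) m) (≤-trans (≤-reflexive i+e+m≡i+z) i+z≤k′)
    i≤k′ = ≤-trans (m≤m+n i e) i+e≤k′
    edge-e : Adj r k′ i (i + e)
    edge-e = (1≤i , i≤k′) , (≤-trans 1≤i (m≤m+n i e) , i+e≤k′) , e , difference∈r z∈ , inj₁ refl
  fold-edge-z {i} {z} 1≤i le z∈ (no i+z≰k′) = subst₂ Path (sym (fold-low i≤k′)) (sym fold-i+z) (edge-e ◅ ε)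
    where
    e = z ∸ m
    i+e+m≡i+z : i + e + m ≡ i + z
    i+e+m≡i+z = trans (+-assoc i e m) (cong (i +_) (m∸n+n≡m (<⇒≤ (m<xs z∈))))
    i+e≤k′ : i + e ≤ k′
    i+e≤k′ = +-cancelʳ-≤ m (i + e) k′ (subst (_≤ k′ + m) (sym i+e+m≡i+z) (subst (i + z ≤_) (+-comm m k′) le))
    i≤k′ = ≤-trans (m≤m+n i e) i+e≤k′
    edge-e : Adj r k′ i (i + e)
    edge-e = (1≤i , i≤k′) , (≤-trans 1≤i (m≤m+n i e) , i+e≤k′) , e , difference∈r z∈ , inj₁ refl
    fold-i+z : fold (i + z) ≡ i + e
    fold-i+z = trans (fold-high (≰⇒> i+z≰k′) (<-≤-trans (m<xs z∈) (m≤n+m z i)))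
                     (trans (cong (_∸ m) (sym i+e+m≡i+z)) (m+n∸n≡m (i + e) m))

  fold-edge : ∀ {i d} → 1 ≤ i → i + d ≤ m + k′ → d ∈ m ∷ xs → Path (fold i) (fold (i + d))
  fold-edge {i}     1≤i le (here refl) = fold-edge-m 1≤i le (i + m ≤? k′)
  fold-edge {i} {z} 1≤i le (there z∈) = fold-edge-z 1≤i le z∈ (i + z ≤? k′)

  fold-path : ∀ {u v} → Connected (m ∷ xs) (m + k′) u v → Path (fold u) (fold v)
  fold-path ε = ε
  fold-path ((vi , vj , d , d∈ , inj₁ refl) ◅ path) = fold-edge (proj₁ vi) (proj₂ vj) d∈ ◅◅ fold-path path
  fold-path ((vi , vj , d , d∈ , inj₂ refl) ◅ path) =
    Star.reverse adj-sym (fold-edge (proj₁ vj) (proj₂ vi) d∈) ◅◅ fold-path path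

  split-pair-lift : ∀ {g} → SplitPair r k′ g → SplitPair (m ∷ xs) (m + k′) g
  split-pair-lift {g} (s , 1≤s , s+g≤k′ , split) = s , 1≤s , ≤-trans s+g≤k′ (m≤n+m k′ m) ,
    λ path → split (subst₂ Path (fold-low (≤-trans (m≤m+n s g) s+g≤k′)) (fold-low s+g≤k′) (fold-path path))

  -- If k′ < m and 0 < g < m, then m ∸ g and m form a split pair of G(m ∷ xs, m + k′):
  -- m is fixed by the folding but lies outside G(r, k′), while m ∸ g folds below m.
  split-pair-new : ∀ {g} → 0 < g → k′ < m → g < m → SplitPair (m ∷ xs) (m + k′) g
  split-pair-new {g} 0<g k′<m g<m =
    m ∸ g , m<n⇒0<n∸m g<m , subst (_≤ m + k′) (sym m∸g+g≡m) (m≤m+n m k′) , split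
    where
    m∸g+g≡m : m ∸ g + g ≡ m
    m∸g+g≡m = m∸n+n≡m (<⇒≤ g<m)
    split : ¬ Connected (m ∷ xs) (m + k′) (m ∸ g) (m ∸ g + g)
    split path = <⇒≱ (∸-monoʳ-< {m} {g} {0} 0<g (<⇒≤ g<m)) (≤-trans (≤-reflexive (sym fold-m∸g≡m)) (fold≤ (m ∸ g)))
      where
      folded : Path (fold (m ∸ g)) (fold m)
      folded = subst (λ t → Path (fold (m ∸ g)) (fold t)) m∸g+g≡m (fold-path path)
      fold-m∸g≡m : fold (m ∸ g) ≡ m
      fold-m∸g≡m = trans (connected-beyond (Star.reverse adj-sym folded) (subst (k′ <_) (sym (fold-middle k′<m ≤-refl)) k′<m))
                         (fold-middle k′<m ≤-refl)

stable? : ∀ q₀ x → Dec (Stable q₀ x)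
stable? q₀ x with gcdL q₀ ≟ gcdL (q₀ ++ x ∷ []) | f q₀ ≤? x
... | yes g≡ | yes f≤ = yes (g≡ , f≤)
... | no g≢  | _      = no (λ s → g≢ (proj₁ s))
... | _      | no f≰  = no (λ s → f≰ (proj₂ s))

-- An unstable pair (q₀, x) always has gcd(q₀ ++ [x]) < min(q₀): otherwise the gcd equals
-- min(q₀), so gcd(q₀) is the same and f(q₀) = max(q₀) < x by f≡maxL.
unstable⇒gcd<minL : ∀ q₀ x → NonEmpty q₀ → Ordered (q₀ ++ x ∷ []) → ¬ Stable q₀ x →
                    gcdL (q₀ ++ x ∷ []) < minL q₀
unstable⇒gcd<minL q₀ x ne ord unstable = ≤∧≢⇒< g≤min g≢min
  where
  g = gcdL (q₀ ++ x ∷ [])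
  ord₀ = proj₁ (ordered-snoc⁻ {q₀} ord)
  min∈q : minL q₀ ∈ q₀ ++ x ∷ []
  min∈q = ∈-++⁺ˡ (minL-∈ ne)
  g≤min : g ≤ minL q₀
  g≤min = gcdL≤ min∈q (All.lookup (proj₂ ord) min∈q)
  g≢min : g ≢ minL q₀
  g≢min g≡min = unstable (gcd≡ , subst (_≤ x) (sym f≡max) (<⇒≤ max<x))
    where
    gcd≡ : gcdL q₀ ≡ g
    gcd≡ = ∣-antisym (subst (gcdL q₀ ∣_) (sym g≡min) (gcdL-∣ (minL-∈ ne)))
                     (gcdL-greatest q₀ (λ y∈ → gcdL-∣ (∈-++⁺ˡ y∈)))
    f≡max : f q₀ ≡ maxL q₀
    f≡max = f≡maxL q₀ ord₀ (trans gcd≡ g≡min)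
    max<x : maxL q₀ < x
    max<x = All.lookup (proj₂ (ordered-snoc⁻ {q₀} ord)) (maxL-∈ (minL-∈ ne))

f-cons≤ : ∀ m cs → Ordered (m ∷ cs) → f (m ∷ cs) ≤ m + f (R (m ∷ cs))
f-cons≤ m []      _   = m≤m+n m m
f-cons≤ m (_ ∷ _) ord = ≤-reflexive (f-step ord)

-- Unless the new difference x ∸ m exceeds m, R (m ∷ cs ++ [x]) ends with m
-- (for cs = [] and x = 2m the gcd would be m itself).
R-ends-with-m : ∀ m cs x → Ordered (m ∷ cs ++ x ∷ []) → gcdL (m ∷ cs ++ x ∷ []) < m → ¬ (m < x ∸ m) →
                ∃[ E ] (NonEmpty E × R (m ∷ cs ++ x ∷ []) ≡ E ++ m ∷ [])
R-ends-with-m m cs x ord g<m m≮x∸m with <-cmp m (x ∸ m)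
... | tri< m<x∸m _ _ = ⊥-elim (m≮x∸m m<x∸m)
... | tri> _ _ x∸m<m = _ , nonEmpty-∈ (∈-map⁺ (λ y → y ∸ m) (∈-++⁺ʳ cs (here refl))) , caseC x∸m<m
  where open Extension m cs x ord
R-ends-with-m m (c ∷ cs) x ord g<m m≮x∸m | tri≈ _ m≡x∸m _ = _ , nonEmpty , caseB-differences (sym m≡x∸m)
  where open Extension m (c ∷ cs) x ord
R-ends-with-m m [] x ord g<m m≮x∸m | tri≈ _ m≡x∸m _ =
  ⊥-elim (<⇒≱ g<m (∣⇒≤ ⦃ >-nonZero (gcdL-positive {m ∷ x ∷ []} (here refl) (All.lookup (proj₂ ord) (here refl))) ⦄ m∣g))
  where
  open Extension m [] x ord
  x≡m+m : x ≡ m + m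
  x≡m+m = trans (sym (m∸n+n≡m (<⇒≤ m<x))) (cong (_+ m) (sym m≡x∸m))
  m∣g : m ∣ gcdL (m ∷ x ∷ [])
  m∣g = gcd-greatest ∣-refl (gcd-greatest (subst (m ∣_) (sym x≡m+m) (∣m∣n⇒∣m+n ∣-refl ∣-refl)) (m ∣0))

-- Induction along R: for q = m ∷ cs ++ [x] we have
-- f q − 1 = m + (f(R q) − 1) and R q = E ++ [y] with y < x, where either y = x ∸ m > m and
-- E = R(m ∷ cs), or y = m. If (E, y) is unstable, the induction hypothesis gives a split pair
-- of G(R q, f(R q) − 1), which lifts by Folding. If (E, y) is stable then f(R q) = y by f-snoc:
-- for y = x ∸ m this would make (m ∷ cs, x) stable; for y = m, Folding creates a split pair.
split-pair : ∀ q₀ x → NonEmpty q₀ → Ordered (q₀ ++ x ∷ []) → ¬ Stable q₀ x →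
             SplitPair (q₀ ++ x ∷ []) (f (q₀ ++ x ∷ []) ∸ 1) (gcdL (q₀ ++ x ∷ []))
split-pair q₀ x ne ord unstable = go (suc x) q₀ x ne ord unstable ≤-refl
  where
  go : ∀ n q₀ x → NonEmpty q₀ → Ordered (q₀ ++ x ∷ []) → ¬ Stable q₀ x → x < n →
       SplitPair (q₀ ++ x ∷ []) (f (q₀ ++ x ∷ []) ∸ 1) (gcdL (q₀ ++ x ∷ []))
  go (suc n) (m ∷ cs) x _ ord unstable x<n = subst (λ k → SplitPair q k g) (sym f∸1≡) split-R
    where
    open Extension m cs x ord
    q = m ∷ cs ++ x ∷ []
    g = gcdL q
    Rq = R q
    k′ = f Rq ∸ 1
    ordR = R-ordered m (cs ++ x ∷ []) ord
    g-R : gcdL Rq ≡ g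
    g-R = gcdL-R m (cs ++ x ∷ []) (proj₁ ord)
    0<m : 0 < m
    0<m = All.lookup (proj₂ ord) (here refl)
    g<m : g < m
    g<m = unstable⇒gcd<minL (m ∷ cs) x nonEmpty ord unstable
    f∸1≡ : f q ∸ 1 ≡ m + k′
    f∸1≡ = trans (cong (_∸ 1) (f-step-snoc cs ord)) (+-∸-assoc m 1≤fR)
      where 1≤fR = ≤-trans 0<m (≤-trans (maxL-greatest (proj₁ ordR) (m∈R m (cs ++ x ∷ []))) (f≥maxL Rq ordR))
    open Folding m k′ Rq (cs ++ x ∷ []) (m∈R m (cs ++ x ∷ [])) (difference∈R m (cs ++ x ∷ [])) (head<tail (proj₁ ord))

    lift-unless-stable : ∀ E y → NonEmpty E → Rq ≡ E ++ y ∷ [] → y < x → SplitPair q (m + k′) g ⊎ Stable E y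
    lift-unless-stable E y neE Rq≡ y<x with stable? E y
    ... | yes stable    = inj₂ stable
    ... | no unstable′  = inj₁ (split-pair-lift (subst₂ (λ l h → SplitPair l (f l ∸ 1) h) (sym Rq≡) g-E
                            (go n E y neE (subst Ordered Rq≡ ordR) unstable′ (≤-trans y<x (≤-pred x<n)))))
      where g-E = trans (cong gcdL (sym Rq≡)) g-R

    stable-cs : m < x ∸ m → Stable (R (m ∷ cs)) (x ∸ m) → Stable (m ∷ cs) x
    stable-cs m<x∸m (g≡ , f≤) = gcd-cs , f-cs
      where
      gcd-cs : gcdL (m ∷ cs) ≡ g
      gcd-cs = trans (sym (gcdL-R m cs (proj₁ ord₀))) (trans g≡ (trans (cong gcdL (sym (caseA m<x∸m))) g-R))
      f-cs : f (m ∷ cs) ≤ x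
      f-cs = ≤-trans (f-cons≤ m cs ord₀) (subst (m + f (R (m ∷ cs)) ≤_) (m+[n∸m]≡n (<⇒≤ m<x)) (+-monoʳ-≤ m f≤))

    -- y = m: stability gives f(R q) = m, so G(R q, k′) lies below m
    split-new : ∀ E → NonEmpty E → Rq ≡ E ++ m ∷ [] → Stable E m → SplitPair q (m + k′) g
    split-new E neE Rq≡ stable = split-pair-new (gcdL-positive {q} (here refl) 0<m) k′<m g<m
      where
      fR≡m : f Rq ≡ m
      fR≡m = trans (cong f Rq≡) (f-snoc E m neE (subst Ordered Rq≡ ordR) stable)
      k′<m : k′ < m
      k′<m = subst (λ t → t ∸ 1 < m) (sym fR≡m) (∸-monoʳ-< {m} {1} {0} (s≤s z≤n) 0<m)

    split-R : SplitPair q (m + k′) g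
    split-R with m <? x ∸ m
    ... | yes m<x∸m = [ id , (λ stable → ⊥-elim (unstable (stable-cs m<x∸m stable))) ]′
      (lift-unless-stable (R (m ∷ cs)) (x ∸ m) (nonEmpty-∈ (m∈R m cs)) (caseA m<x∸m)
                          (∸-monoʳ-< {x} {m} {0} 0<m (<⇒≤ m<x)))
    ... | no m≮x∸m with R-ends-with-m m cs x ord g<m m≮x∸m
    ...   | E , neE , Rq≡ = [ id , split-new E neE Rq≡ ]′ (lift-unless-stable E m neE Rq≡ m<x)

fwRev-step : ∀ x y ys → let q₀ = reverse (y ∷ ys) in
  (Stable q₀ x × fwRev (x ∷ y ∷ ys) ≡ fwRev (y ∷ ys)) ⊎
  (¬ Stable q₀ x × fwRev (x ∷ y ∷ ys) ≡ f (reverse (x ∷ y ∷ ys)))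
fwRev-step x y ys
  with gcdL (reverse (y ∷ ys)) ≡ᵇ gcdL (reverse (x ∷ y ∷ ys)) in gcd-test | f (reverse (y ∷ ys)) ≤ᵇ x in f-test
... | true  | true  = inj₁ ((gcd≡ , ≤ᵇ⇒≤ _ x (subst T (sym f-test) tt)) , refl)
  where gcd≡ = trans (≡ᵇ⇒≡ _ _ (subst T (sym gcd-test) tt)) (cong gcdL (unfold-reverse x (y ∷ ys)))
... | true  | false = inj₂ ((λ stable → subst T f-test (≤⇒≤ᵇ (proj₂ stable))) , refl)
... | false | _     = inj₂ ((λ stable → subst T gcd-test (≡⇒≡ᵇ _ _ (trans (proj₁ stable)
                               (sym (cong gcdL (unfold-reverse x (y ∷ ys))))))) , refl)

ordered-init : ∀ x y ys → Ordered (reverse (x ∷ y ∷ ys)) → Ordered (reverse (y ∷ ys))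
ordered-init x y ys ord = proj₁ (ordered-snoc⁻ {reverse (y ∷ ys)} (subst Ordered (unfold-reverse x (y ∷ ys)) ord))

-- fw(p) ≤ f(p): each step either keeps fw(q₀) ≤ f(q₀) ≤ x ≤ f(p), or takes fw(p) = f(p).
fwRev≤f : ∀ rs → Ordered (reverse rs) → fwRev rs ≤ f (reverse rs)
fwRev≤f []           _   = z≤n
fwRev≤f (x ∷ [])     _   = ≤-refl
fwRev≤f (x ∷ y ∷ ys) ord =
  [ stable-step (fwRev≤f (y ∷ ys) (ordered-init x y ys ord)) , (λ (_ , fw≡f) → ≤-reflexive fw≡f) ]′
  (fwRev-step x y ys)
  where
  ord′ = subst Ordered (unfold-reverse x (y ∷ ys)) ord
  stable-step : fwRev (y ∷ ys) ≤ f (reverse (y ∷ ys)) →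
                Stable (reverse (y ∷ ys)) x × fwRev (x ∷ y ∷ ys) ≡ fwRev (y ∷ ys) →
                fwRev (x ∷ y ∷ ys) ≤ f (reverse (x ∷ y ∷ ys))
  stable-step fw₀≤f₀ ((_ , f₀≤x) , fw≡fw₀) = begin
    fwRev (x ∷ y ∷ ys)                 ≡⟨ fw≡fw₀ ⟩
    fwRev (y ∷ ys)                     ≤⟨ fw₀≤f₀ ⟩
    f (reverse (y ∷ ys))               ≤⟨ f₀≤x ⟩
    x                                  ≡⟨ maxL-snoc (reverse (y ∷ ys)) x ⟨
    maxL (reverse (y ∷ ys) ++ x ∷ [])  ≤⟨ f≥maxL _ ord′ ⟩
    f (reverse (y ∷ ys) ++ x ∷ [])     ≡⟨ cong f (unfold-reverse x (y ∷ ys)) ⟨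
    f (reverse (x ∷ y ∷ ys))           ∎
    where open ≤-Reasoning

split-pair-snoc : ∀ {q₀ x k g} → k ≤ x → SplitPair q₀ k g → SplitPair (q₀ ++ x ∷ []) k g
split-pair-snoc k≤x (s , 1≤s , s+g≤k , split) =
  s , 1≤s , s+g≤k , λ path → split (connected-drop-large path k≤x)

-- The split pair for G'_p: follow the fw recursion down to the last unstable step, where the
-- main lemma applies; the entries appended afterwards are ≥ fw and add no edges.
fw-split-pair : ∀ rs → Ordered (reverse rs) → minL (reverse rs) ≢ gcdL (reverse rs) →
                SplitPair (reverse rs) (fwRev rs ∸ 1) (gcdL (reverse rs))
fw-split-pair []           _   min≢gcd = ⊥-elim (min≢gcd refl)
fw-split-pair (x ∷ [])     _   min≢gcd = ⊥-elim (min≢gcd (sym (gcd-identityʳ x)))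
fw-split-pair (x ∷ y ∷ ys) ord min≢gcd =
  [ stable-step (fw-split-pair (y ∷ ys) ord₀) (fwRev≤f (y ∷ ys) ord₀) , unstable-step ]′ (fwRev-step x y ys)
  where
  q₀ = reverse (y ∷ ys)
  q₀x = q₀ ++ x ∷ []
  rev≡ : reverse (x ∷ y ∷ ys) ≡ q₀x
  rev≡ = unfold-reverse x (y ∷ ys)
  ord₀ = ordered-init x y ys ord

  -- fw(p) = fw(q₀): the split pair of G(q₀, fw q₀ − 1) survives appending x ≥ f(q₀) ≥ fw(q₀)
  stable-step : (minL q₀ ≢ gcdL q₀ → SplitPair q₀ (fwRev (y ∷ ys) ∸ 1) (gcdL q₀)) →
                fwRev (y ∷ ys) ≤ f q₀ →
                Stable q₀ x × fwRev (x ∷ y ∷ ys) ≡ fwRev (y ∷ ys) →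
                SplitPair (reverse (x ∷ y ∷ ys)) (fwRev (x ∷ y ∷ ys) ∸ 1) (gcdL (reverse (x ∷ y ∷ ys)))
  stable-step IH₀ fw₀≤f₀ ((gcd≡ , f₀≤x) , fw≡fw₀) =
    subst (λ l → SplitPair l (fwRev (x ∷ y ∷ ys) ∸ 1) (gcdL l)) (sym rev≡)
      (subst (λ k → SplitPair q₀x (k ∸ 1) (gcdL q₀x)) (sym fw≡fw₀)
        (split-pair-snoc k≤x (subst (SplitPair q₀ (fwRev (y ∷ ys) ∸ 1)) gcd≡ IH)))
    where
    min≡ : minL q₀ ≡ minL (reverse (x ∷ y ∷ ys))
    min≡ = sym (trans (cong minL rev≡) (minL-snoc (reverse-nonEmpty y ys)))
    IH = IH₀ (λ eq → min≢gcd (trans (sym min≡) (trans eq (trans gcd≡ (sym (cong gcdL rev≡))))))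
    k≤x : fwRev (y ∷ ys) ∸ 1 ≤ x
    k≤x = ≤-trans (m∸n≤m _ 1) (≤-trans fw₀≤f₀ f₀≤x)

  unstable-step : ¬ Stable q₀ x × fwRev (x ∷ y ∷ ys) ≡ f (reverse (x ∷ y ∷ ys)) →
                  SplitPair (reverse (x ∷ y ∷ ys)) (fwRev (x ∷ y ∷ ys) ∸ 1) (gcdL (reverse (x ∷ y ∷ ys)))
  unstable-step (unstable , fw≡f) =
    subst (λ k → SplitPair (reverse (x ∷ y ∷ ys)) (k ∸ 1) (gcdL (reverse (x ∷ y ∷ ys)))) (sym fw≡f)
      (subst (λ l → SplitPair l (f l ∸ 1) (gcdL l)) (sym rev≡)
        (split-pair q₀ x (reverse-nonEmpty y ys) (subst Ordered rev≡ ord) unstable))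

proposition27 : (p : List ℕ) → IsOFS p → minL p ≢ gcdL p →
    G'MoreComponentsThan p (gcdL p)
proposition27 p ofs min≢gcd = split-pair⇒components ⦃ >-nonZero 0<gcd ⦄ gcdL-∣ split
  where
  open IsOFS ofs
  ord : Ordered p
  ord = Linked⇒AllPairs <-trans increasing , positive
  0<gcd : 0 < gcdL p
  0<gcd = gcdL-positive (minL-∈ nonempty) (All.lookup positive (minL-∈ nonempty))
  rev-rev = reverse-involutive p
  split : SplitPair p (fw p ∸ 1) (gcdL p)
  split = subst (λ l → SplitPair l (fw p ∸ 1) (gcdL l)) rev-rev
            (fw-split-pair (reverse p) (subst Ordered (sym rev-rev) ord)
                           (subst (λ l → minL l ≢ gcdL l) (sym rev-rev) min≢gcd))
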